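{- No threshold function is discriminatory.
   Context: A threshold function is a Boolean function $f(x_1,\ldots,x_n)$ such that for some reals $\alpha_0,\alpha_1,\ldots,\alpha_n$, $f(x)=1\iff\alpha_1x_1+\cdots+\alpha_nx_n\ge\alpha_0$. A variable $x_i$ is essential for a function if there are two inputs differing only in $x_i$ on which the function takes different values, and fictitious otherwise. For a total assignment $a$ to a subset $X'$ of the variables $X$ of $f$, $f_a$ denotes the function of the variables $X\setminus X'$ obtained by fixing the variables in $X'$ according to $a$. A Boolean function $f$ of variables $X$, all of which are essential for $f$, is discriminatory if there exists a nonempty subset $X'\subseteq X$ such that for every total assignment $a$ to $X'$, the function $f_a$ has at least one fictitious variable from $X\setminus X'$. (Only functions all of whose variables are essential are considered in this definition.)
   Formalization: The weights α₀, α₁, …, αₙ in the definition of a threshold function are rational rather than real. -}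

module Defs where

open import Data.Bool using (Bool; true; false; not; if_then_else_)
open import Data.Nat using (ℕ; zero; suc)
open import Data.Fin using (Fin; zero; suc)
open import Data.Fin.Subset using (Subset; _∈_; _∉_; Nonempty)
open import Data.Vec using (lookup)
open import Data.Rational using (ℚ; 0ℚ; _+_; _≤_)
open import Data.Product using (Σ; ∃; _×_; _,_)
open import Function using (_∘_; _⇔_)
open import Relation.Binary.PropositionalEquality using (_≡_; _≢_)

BoolFun : ℕ → Set
BoolFun n = (Fin n → Bool) → Bool

flipAt : ∀ {n} → Fin n → (Fin n → Bool) → (Fin n → Bool)
flipAt {suc n} zero    x zero    = not (x zero)
flipAt {suc n} zero    x (suc j) = x (suc j)
flipAt {suc n} (suc i) x zero    = x zero
flipAt {suc n} (suc i) x (suc j) = flipAt i (x ∘ suc) j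

wsum : ∀ {n} → (Fin n → ℚ) → (Fin n → Bool) → ℚ
wsum {zero}  α x = 0ℚ
wsum {suc n} α x = (if x zero then α zero else 0ℚ) + wsum (α ∘ suc) (x ∘ suc)

IsThreshold : ∀ {n} → BoolFun n → Set
IsThreshold {n} f =
  Σ ℚ λ α₀ → Σ (Fin n → ℚ) λ α →
    ∀ (x : Fin n → Bool) → (f x ≡ true) ⇔ (α₀ ≤ wsum α x)

Essential : ∀ {n} → BoolFun n → Fin n → Set
Essential f i = ∃ λ x → f x ≢ f (flipAt i x)

Fictitious : ∀ {n} → BoolFun n → Fin n → Set
Fictitious f i = ∀ x → f x ≡ f (flipAt i x)

-- Restriction f_a: fix the variables in S according to a; the remaining
-- inputs are read from y (coordinates of y inside S and of a outside S
-- are ignored).  Its variables are those outside S.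
restrict : ∀ {n} → BoolFun n → Subset n → (Fin n → Bool) → BoolFun n
restrict f S a y = f (λ i → if lookup S i then a i else y i)

Discriminatory : ∀ {n} → BoolFun n → Set
Discriminatory {n} f =
  (∀ i → Essential f i) ×
  Σ (Subset n) λ S → Nonempty S ×
    (∀ (a : Fin n → Bool) → ∃ λ j → j ∉ S × Fictitious (restrict f S a) j)

-- Take a variable m outside S of least absolute weight; being essential, flipping
-- it changes f at some input x.  Fixing S as in x makes some variable k outside S
-- fictitious, and ∣ α m ∣ ≤ ∣ α k ∣.  Since f only depends on whether the weighted
-- sum reaches α₀, which is monotone in the sum, look at the sums p, p + a, p + b and
-- p + a + b at x and after flipping m, k or both: the test is constant from p to
-- p + b and from p + a to p + a + b, and because ∣ a ∣ ≤ ∣ b ∣ one of these two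
-- intervals contains both p and p + a.  So flipping m does not change f after all.
module Submission where

open import Defs
open import Data.Bool using (Bool; true; false; if_then_else_)
open import Data.Empty using (⊥-elim)
open import Data.Fin using (Fin; zero; suc; _≟_)
open import Data.Fin.Subset using (Subset; _∈_; _∉_)
open import Data.Fin.Subset.Properties using (_∈?_)
open import Data.Nat using (ℕ; zero; suc)
open import Data.Product using (∃; _×_; _,_)
open import Data.Rational using (ℚ; 0ℚ; _+_; -_; ∣_∣; _≤_)
import Data.Rational.Properties as ℚ
open import Algebra.Properties.Group ℚ.+-0-group using (⁻¹-involutive)
open import Data.Rational.Solver using (module +-*-Solver)
open import Data.Sum using (_⊎_; inj₁; inj₂)
open import Data.Vec using (lookup)
open import Data.Vec.Properties using (lookup⇒[]=)
open import Function using (_∘_; _⇔_; mk⇔; Equivalence)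
import Function.Properties.Equivalence as ⇔
open import Level using (Level)
open import Relation.Binary.Bundles using (TotalPreorder)
open import Relation.Binary.Definitions using (_Respects_)
open import Relation.Binary.PropositionalEquality
open import Relation.Nullary using (¬_; yes; no)
open import Relation.Nullary.Decidable using (¬?)
open import Relation.Unary using (Pred; Decidable)

open Equivalence using (to; from)

module _ {a ℓ₁ ℓ₂ p : Level} (O : TotalPreorder a ℓ₁ ℓ₂) where
  open TotalPreorder O using (Carrier; _≲_; total) renaming (refl to ≲-refl; trans to ≲-trans)

  argmin : ∀ {n} (P : Pred (Fin n) p) → Decidable P → (key : Fin n → Carrier) →
           (∀ i → ¬ P i) ⊎ ∃ λ m → P m × (∀ i → P i → key m ≲ key i)
  argmin {zero}  P P? key = inj₁ λ ()
  argmin {suc n} P P? key with argmin (P ∘ suc) (P? ∘ suc) (key ∘ suc) | P? zero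
  ... | inj₁ none | no ¬P0 = inj₁ λ { zero P0 → ¬P0 P0 ; (suc i) Pi → none i Pi }
  ... | inj₁ none | yes P0 =
    inj₂ (zero , P0 , λ { zero _ → ≲-refl ; (suc i) Pi → ⊥-elim (none i Pi) })
  ... | inj₂ (m , Pm , min) | no ¬P0 =
    inj₂ (suc m , Pm , λ { zero P0 → ⊥-elim (¬P0 P0) ; (suc i) Pi → min i Pi })
  ... | inj₂ (m , Pm , min) | yes P0 with total (key zero) (key (suc m))
  ...   | inj₁ k0≲km = inj₂ (zero , P0 , λ { zero _ → ≲-refl ; (suc i) Pi → ≲-trans k0≲km (min i Pi) })
  ...   | inj₂ km≲k0 = inj₂ (suc m , Pm , λ { zero _ → km≲k0 ; (suc i) Pi → min i Pi })

p≤p+q : ∀ p {q} → 0ℚ ≤ q → p ≤ p + q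
p≤p+q p 0≤q = subst (_≤ p + _) (ℚ.+-identityʳ p) (ℚ.+-monoʳ-≤ p 0≤q)

p+q≤p : ∀ p {q} → q ≤ 0ℚ → p + q ≤ p
p+q≤p p q≤0 = subst (p + _ ≤_) (ℚ.+-identityʳ p) (ℚ.+-monoʳ-≤ p q≤0)

p≤0⇒∣p∣≡-p : ∀ {p} → p ≤ 0ℚ → ∣ p ∣ ≡ - p
p≤0⇒∣p∣≡-p {p} p≤0 = trans (sym (ℚ.∣-p∣≡∣p∣ p)) (ℚ.0≤p⇒∣p∣≡p (ℚ.neg-antimono-≤ p≤0))

module _ {P : ℚ → Set} (mono : P Respects _≤_) where

  ⇔-between : ∀ {q r s} → q ≤ r → r ≤ s → P q ⇔ P s → P q ⇔ P r
  ⇔-between q≤r r≤s q⇔s = mk⇔ (mono q≤r) (from q⇔s ∘ mono r≤s)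

  ⇔-shift : ∀ p a b → ∣ a ∣ ≤ ∣ b ∣ →
            P p ⇔ P (p + b) → P (p + a) ⇔ P (p + a + b) → P p ⇔ P (p + a)
  ⇔-shift p a b ∣a∣≤∣b∣ H₁ H₂ with ℚ.≤-total 0ℚ a | ℚ.≤-total 0ℚ b
  ... | inj₁ 0≤a | inj₁ 0≤b = ⇔-between (p≤p+q p 0≤a) (ℚ.+-monoʳ-≤ p a≤b) H₁
    where
    a≤b : a ≤ b
    a≤b = subst₂ _≤_ (ℚ.0≤p⇒∣p∣≡p 0≤a) (ℚ.0≤p⇒∣p∣≡p 0≤b) ∣a∣≤∣b∣
  ... | inj₁ 0≤a | inj₂ b≤0 =
    ⇔.trans (⇔.sym (⇔-between p+a+b≤p (p≤p+q p 0≤a) (⇔.sym H₂))) (⇔.sym H₂)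
    where
    a+b≤0 : a + b ≤ 0ℚ
    a+b≤0 = subst (a + b ≤_) (ℚ.+-inverseˡ b)
              (ℚ.+-monoˡ-≤ b (subst₂ _≤_ (ℚ.0≤p⇒∣p∣≡p 0≤a) (p≤0⇒∣p∣≡-p b≤0) ∣a∣≤∣b∣))
    p+a+b≤p : p + a + b ≤ p
    p+a+b≤p = subst (_≤ p) (sym (ℚ.+-assoc p a b)) (p+q≤p p a+b≤0)
  ... | inj₂ a≤0 | inj₁ 0≤b = ⇔.sym (⇔-between (p+q≤p p a≤0) p≤p+a+b H₂)
    where
    0≤a+b : 0ℚ ≤ a + b
    0≤a+b = subst₂ _≤_ (ℚ.+-inverseˡ a) (ℚ.+-comm b a)
              (ℚ.+-monoˡ-≤ a (subst₂ _≤_ (p≤0⇒∣p∣≡-p a≤0) (ℚ.0≤p⇒∣p∣≡p 0≤b) ∣a∣≤∣b∣))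
    p≤p+a+b : p ≤ p + a + b
    p≤p+a+b = subst (p ≤_) (sym (ℚ.+-assoc p a b)) (p≤p+q p 0≤a+b)
  ... | inj₂ a≤0 | inj₂ b≤0 =
    ⇔.trans H₁ (⇔-between (ℚ.+-monoʳ-≤ p b≤a) (p+q≤p p a≤0) (⇔.sym H₁))
    where
    b≤a : b ≤ a
    b≤a = subst₂ _≤_ (⁻¹-involutive b) (⁻¹-involutive a)
            (ℚ.neg-antimono-≤ (subst₂ _≤_ (p≤0⇒∣p∣≡-p a≤0) (p≤0⇒∣p∣≡-p b≤0) ∣a∣≤∣b∣))

flipAt-≢ : ∀ {n} (k : Fin n) x {i} → i ≢ k → flipAt k x i ≡ x i
flipAt-≢ zero    x {zero}  i≢k = ⊥-elim (i≢k refl)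
flipAt-≢ zero    x {suc i} i≢k = refl
flipAt-≢ (suc k) x {zero}  i≢k = refl
flipAt-≢ (suc k) x {suc i} i≢k = flipAt-≢ k (x ∘ suc) (i≢k ∘ cong suc)

flipGain : ∀ {n} → (Fin n → ℚ) → Fin n → (Fin n → Bool) → ℚ
flipGain α k x = if x k then - α k else α k

∣flipGain∣ : ∀ {n} (α : Fin n → ℚ) k x → ∣ flipGain α k x ∣ ≡ ∣ α k ∣
∣flipGain∣ α k x with x k
... | true  = ℚ.∣-p∣≡∣p∣ (α k)
... | false = refl

wsum-cong : ∀ {n} (α : Fin n → ℚ) {x y} → x ≗ y → wsum α x ≡ wsum α y
wsum-cong {zero}  α x≗y = refl
wsum-cong {suc n} α x≗y =
  cong₂ (λ b s → (if b then α zero else 0ℚ) + s) (x≗y zero) (wsum-cong (α ∘ suc) (x≗y ∘ suc))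

wsum-flipAt : ∀ {n} (α : Fin n → ℚ) k x → wsum α (flipAt k x) ≡ wsum α x + flipGain α k x
wsum-flipAt α zero x with x zero
... | true  = solve 2 (λ a w → con 0ℚ :+ w := (a :+ w) :+ :- a) refl (α zero) (wsum (α ∘ suc) (x ∘ suc))
  where open +-*-Solver
... | false = solve 2 (λ a w → a :+ w := (con 0ℚ :+ w) :+ a) refl (α zero) (wsum (α ∘ suc) (x ∘ suc))
  where open +-*-Solver
wsum-flipAt α (suc k) x = trans
  (cong (c +_) (wsum-flipAt (α ∘ suc) k (x ∘ suc)))
  (sym (ℚ.+-assoc c (wsum (α ∘ suc) (x ∘ suc)) (flipGain α (suc k) x)))
  where c = if x zero then α zero else 0ℚ

AgreeOn : ∀ {n} → Subset n → (Fin n → Bool) → (Fin n → Bool) → Set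
AgreeOn S a y = ∀ {i} → i ∈ S → y i ≡ a i

flipAt-agreeOn : ∀ {n} {S : Subset n} {a y k} → k ∉ S → AgreeOn S a y → AgreeOn S a (flipAt k y)
flipAt-agreeOn {y = y} {k} k∉S y≈a {i} i∈S =
  trans (flipAt-≢ k y λ { refl → k∉S i∈S }) (y≈a i∈S)

fixOn : ∀ {n} → Subset n → (Fin n → Bool) → (Fin n → Bool) → Fin n → Bool
fixOn S a y i = if lookup S i then a i else y i

fixOn-agreeing : ∀ {n} {S : Subset n} {a y} → AgreeOn S a y → fixOn S a y ≗ y
fixOn-agreeing {S = S} {a} {y} y≈a i with lookup S i in S[i]
... | true  = sym (y≈a (lookup⇒[]= i S S[i]))
... | false = refl

≡true-⇔⇒≡ : ∀ {b c} → (b ≡ true) ⇔ (c ≡ true) → b ≡ c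
≡true-⇔⇒≡ {true}  {true}  _ = refl
≡true-⇔⇒≡ {false} {false} _ = refl
≡true-⇔⇒≡ {true}  {false} b⇔c = sym (to b⇔c refl)
≡true-⇔⇒≡ {false} {true}  b⇔c = from b⇔c refl

module Threshold {n} {f : BoolFun n} {α₀ : ℚ} {α : Fin n → ℚ}
                 (threshold : ∀ x → (f x ≡ true) ⇔ (α₀ ≤ wsum α x)) where

  Reaches : ℚ → Set
  Reaches = α₀ ≤_

  reaches-mono : Reaches Respects _≤_
  reaches-mono q≤r α₀≤q = ℚ.≤-trans α₀≤q q≤r

  ⇔⇒f≡ : ∀ {x y} → Reaches (wsum α x) ⇔ Reaches (wsum α y) → f x ≡ f y
  ⇔⇒f≡ {x} {y} x⇔y = ≡true-⇔⇒≡ (⇔.trans (threshold x) (⇔.trans x⇔y (⇔.sym (threshold y))))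

  f≡⇒⇔ : ∀ {x y} → f x ≡ f y → Reaches (wsum α x) ⇔ Reaches (wsum α y)
  f≡⇒⇔ {x} {y} fx≡fy =
    ⇔.trans (⇔.sym (threshold x)) (⇔.trans (mk⇔ (trans (sym fx≡fy)) (trans fx≡fy)) (threshold y))

  fictitious⇒⇔ : ∀ {S : Subset n} {a k} → k ∉ S → Fictitious (restrict f S a) k →
                 ∀ {y} → AgreeOn S a y → Reaches (wsum α y) ⇔ Reaches (wsum α (flipAt k y))
  fictitious⇒⇔ k∉S fictitious {y} y≈a =
    subst₂ (λ u v → Reaches u ⇔ Reaches v)
      (wsum-cong α (fixOn-agreeing y≈a))
      (wsum-cong α (fixOn-agreeing (flipAt-agreeOn k∉S y≈a)))
      (f≡⇒⇔ (fictitious y))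

  heavier-not-fictitious : ∀ {S : Subset n} {x j k} → j ∉ S → k ∉ S → ∣ α j ∣ ≤ ∣ α k ∣ →
                           f x ≢ f (flipAt j x) → ¬ Fictitious (restrict f S x) k
  heavier-not-fictitious {S} {x} {j} {k} j∉S k∉S ∣αj∣≤∣αk∣ essential fictitious with k ≟ j
  ... | yes refl = essential (⇔⇒f≡ (fictitious⇒⇔ k∉S fictitious (λ _ → refl)))
  ... | no k≢j = essential (⇔⇒f≡ (subst (λ u → Reaches p ⇔ Reaches u) (sym W[x⊕j])
                   (⇔-shift reaches-mono p a b ∣a∣≤∣b∣ H₁ H₂)))
    where
    flip-k = fictitious⇒⇔ k∉S fictitious
    p = wsum α x
    a = flipGain α j x
    b = flipGain α k x

    ∣a∣≤∣b∣ : ∣ a ∣ ≤ ∣ b ∣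
    ∣a∣≤∣b∣ = subst₂ _≤_ (sym (∣flipGain∣ α j x)) (sym (∣flipGain∣ α k x)) ∣αj∣≤∣αk∣

    W[x⊕j] : wsum α (flipAt j x) ≡ p + a
    W[x⊕j] = wsum-flipAt α j x

    W[x⊕j⊕k] : wsum α (flipAt k (flipAt j x)) ≡ p + a + b
    W[x⊕j⊕k] = trans (wsum-flipAt α k (flipAt j x))
      (cong₂ _+_ W[x⊕j] (cong (λ c → if c then - α k else α k) (flipAt-≢ j x k≢j)))

    H₁ : Reaches p ⇔ Reaches (p + b)
    H₁ = subst (λ u → Reaches p ⇔ Reaches u) (wsum-flipAt α k x) (flip-k (λ _ → refl))

    H₂ : Reaches (p + a) ⇔ Reaches (p + a + b)
    H₂ = subst₂ (λ u v → Reaches u ⇔ Reaches v) W[x⊕j] W[x⊕j⊕k]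
           (flip-k (flipAt-agreeOn j∉S (λ _ → refl)))

claim1 : ∀ (n : ℕ) (f : BoolFun n) → IsThreshold f → ¬ Discriminatory f
claim1 n f (α₀ , α , threshold) (essential , S , _ , fictitious)
  with fictitious (λ _ → false)
     | argmin ℚ.≤-totalPreorder (_∉ S) (λ i → ¬? (i ∈? S)) (∣_∣ ∘ α)
... | j₀ , j₀∉S , _ | inj₁ none = none j₀ j₀∉S
... | _ | inj₂ (m , m∉S , lightest) with essential m
...   | x , flip-m-changes with fictitious x
...     | k , k∉S , k-fictitious =
  Threshold.heavier-not-fictitious threshold m∉S k∉S (lightest k k∉S) flip-m-changes k-fictitious
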